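{- Let $G$ be an $n$-vertex graph in which every pair of non-adjacent vertices $u,v$ satisfies $\deg(u)+\deg(v)\ge \lfloor 4n/3\rfloor+1$. Alternatively, let $G$ be a balanced bipartite graph on $2n$ vertices in which every pair of non-adjacent vertices $u,v$ lying in different halves of the bipartition satisfies $\deg(u)+\deg(v)\ge \lfloor 4n/3\rfloor+1$. Then any two perfect matchings $M,M'$ of $G$ with $|M\,\Delta\,M'|\le 6$ are equivalent via $2$-switches, i.e. there is a sequence $M=N_0,N_1,\dots,N_t=M'$ of perfect matchings of $G$ with $|N_{i-1}\,\Delta\,N_i|\le 4$ for all $i\in[t]$. -}

module Defs where

open import Data.Nat using (ℕ; zero; suc; _+_; _*_; _≤_; _<ᵇ_)
open import Data.Nat.DivMod using (_/_)
open import Data.Fin using (Fin; toℕ) renaming (zero to fzero; suc to fsuc)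
open import Data.Bool using (Bool; true; false; if_then_else_; _∧_; _xor_)
open import Relation.Binary.PropositionalEquality using (_≡_; _≢_)
open import Relation.Binary.Construct.Closure.ReflexiveTransitive using (Star)

count : ∀ {n} → (Fin n → Bool) → ℕ
count {zero}  f = 0
count {suc n} f = (if f fzero then 1 else 0) + count (λ i → f (fsuc i))

record Graph (n : ℕ) : Set where
  field
    adj    : Fin n → Fin n → Bool
    sym    : ∀ u v → adj u v ≡ adj v u
    irrefl : ∀ v → adj v v ≡ false
open Graph public

deg : ∀ {n} → Graph n → Fin n → ℕ
deg G v = count (adj G v)

record PerfectMatching {n : ℕ} (G : Graph n) : Set where
  field
    edge    : Fin n → Fin n → Bool
    edgeSym : ∀ u v → edge u v ≡ edge v u
    sub     : ∀ u v → edge u v ≡ true → adj G u v ≡ true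
    perfect : ∀ v → count (edge v) ≡ 1
open PerfectMatching public

sumFin : ∀ {n} → (Fin n → ℕ) → ℕ
sumFin {zero}  f = 0
sumFin {suc n} f = f fzero + sumFin (λ i → f (fsuc i))

symDiffSize : ∀ {n} {G : Graph n} → PerfectMatching G → PerfectMatching G → ℕ
symDiffSize M M' =
  sumFin (λ u → count (λ v → (toℕ u <ᵇ toℕ v) ∧ (edge M u v xor edge M' u v)))

TwoSwitch : ∀ {n} {G : Graph n} → PerfectMatching G → PerfectMatching G → Set
TwoSwitch N N' = symDiffSize N N' ≤ 4

Equiv2Switch : ∀ {n} {G : Graph n} → PerfectMatching G → PerfectMatching G → Set
Equiv2Switch {G = G} = Star (TwoSwitch {G = G})

OreCondition : ∀ {n} → Graph n → Set
OreCondition {n} G = ∀ u v → u ≢ v → adj G u v ≡ false →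
  suc ((4 * n) / 3) ≤ deg G u + deg G v

record BalancedBipartition (n : ℕ) (G : Graph (n + n)) : Set where
  field
    side      : Fin (n + n) → Bool
    balanced  : count side ≡ n
    crossing  : ∀ u v → adj G u v ≡ true → side u ≢ side v
open BalancedBipartition public

BipOreCondition : ∀ {n} {G : Graph (n + n)} → BalancedBipartition n G → Set
BipOreCondition {n} {G} B = ∀ u v → side {n} B u ≢ side {n} B v → adj G u v ≡ false →
  suc ((4 * n) / 3) ≤ deg G u + deg G v

{-# OPTIONS --safe #-}
module Submission where

-- A perfect matching is identified with its fixed-point-free involution u ↦ mate u, and
-- |M Δ M'| is then the number of vertices whose mates differ.  If it exceeds 4, walking
-- alternately along M and M' from such a vertex shows that M Δ M' is one alternating
-- hexagon c₀ … c₅: a 4-cycle or a longer walk would produce seven differing vertices.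
-- If a long diagonal cᵢcᵢ₊₃ is an edge, two 2-switches go from M to M'.  Otherwise the
-- Ore condition on the three diagonals gives Σᵢ deg cᵢ ≥ 3(⌊4n/3⌋+1) > 4n, and double
-- counting over the edges of M yields an edge xy of M with at least 9 neighbours in the
-- hexagon (at least 5 in the bipartite case, where x and y each see only one colour
-- class).  Such an edge lies outside the hexagon, and on the eight vertices of the
-- hexagon and xy a sequence of 2-switches from M to M' is found by exhaustive
-- computation over all possible adjacencies between {x, y} and the hexagon.

open import Defs renaming (sym to adj-sym)
open import Data.Nat.Properties hiding (_≟_)
open import Algebra.Properties.CommutativeMonoid.Sum +-0-commutativeMonoid
  using (sum; sum-cong-≗; ∑-comm; ∑-distrib-+; sum-permute)
open import Data.Bool using (Bool; true; false; not; _∧_; _∨_; _xor_; if_then_else_; T) renaming (_≟_ to _≟ᵇ_)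
open import Data.Bool.Properties
  using (∧-zeroʳ; ∧-identityʳ; ∧-conicalˡ; ∧-conicalʳ; xor-identityʳ; not-involutive; not-¬; ¬-not)
open import Data.Empty using (⊥-elim)
open import Data.Fin using (Fin; zero; suc; toℕ)
open import Data.Fin.Patterns using (0F; 1F; 2F; 3F; 4F; 5F; 6F; 7F)
open import Data.Fin.Permutation using (permutation)
open import Data.Fin.Properties using (_≟_; any?; all?; toℕ-injective)
open import Data.List as List using (List; []; _∷_; length; allFin; filter; map)
open import Data.List.Membership.Propositional using (_∈_; _∉_)
open import Data.List.Membership.Propositional.Properties using (∈-filter⁺; ∈-allFin; ∈-map⁺)
open import Data.List.Properties using (length-map; length-tabulate)
open import Data.List.Relation.Unary.All as All using (All; []; _∷_)
open import Data.List.Relation.Unary.All.Properties using (tabulate⁺)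
open import Data.List.Relation.Unary.AllPairs using ([]; _∷_)
open import Data.List.Relation.Unary.Any as Any using (Any; here; there)
open import Data.List.Relation.Unary.Unique.Propositional using (Unique)
import Data.List.Relation.Unary.Unique.Propositional.Properties as Unique
open import Data.Nat using (ℕ; zero; suc; _+_; _*_; _≤_; _<_; _<ᵇ_; z≤n; s≤s; ⌊_/2⌋; _≤?_; _<?_)
open import Data.Nat.DivMod using (_/_; _%_; m≡m%n+[m/n]*n; m%n<n)
open import Data.Nat.Tactic.RingSolver using (solve-∀)
open import Data.Product using (∃; _×_; _,_; proj₁; proj₂; uncurry)
open import Data.Sum using (_⊎_; inj₁; inj₂; [_,_]′)
open import Data.Unit using (tt)
open import Data.Vec using (Vec; []; _∷_; lookup; tabulate)
open import Data.Vec.Properties using (lookup∘tabulate)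
open import Data.Vec.Relation.Unary.All as VecAll using ([]; _∷_)
open import Data.Vec.Relation.Unary.All.Properties using (lookup⁺; lookup⁻)
open import Data.Vec.Relation.Unary.AllPairs using ([]; _∷_)
import Data.Vec.Relation.Unary.Unique.Propositional as Vec
open import Data.Vec.Relation.Unary.Unique.Propositional.Properties using (lookup-injective)
open import Function using (_∘_; _$_)
open import Relation.Binary.Construct.Closure.ReflexiveTransitive using (ε; _◅_)
open import Relation.Binary.PropositionalEquality
open import Relation.Nullary using (Dec; yes; no; does; ¬?)
open import Relation.Nullary.Decidable
  using (from-yes; dec-true; dec-false; decidable-stable; _×-dec_; _→-dec_; map′)
open import Relation.Unary using (Decidable)

private
  variable
    n k : ℕ

-- Counting over Fin n

infix 4 _==_
_==_ : Fin n → Fin n → Bool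
a == b = does (a ≟ b)

==⇒≡ : {a b : Fin n} → (a == b) ≡ true → a ≡ b
==⇒≡ {a = a} {b} eq with a ≟ b
... | yes a≡b = a≡b

==-refl : (a : Fin n) → (a == a) ≡ true
==-refl a = dec-true (a ≟ a) refl

≢⇒==-false : {a b : Fin n} → a ≢ b → (a == b) ≡ false
≢⇒==-false {a = a} {b} = dec-false (a ≟ b)

not-==⇒≢ : {a b : Fin n} → not (a == b) ≡ true → a ≢ b
not-==⇒≢ {a = a} neq refl with () ← trans (sym neq) (cong not (==-refl a))

≢⇒not-== : {a b : Fin n} → a ≢ b → not (a == b) ≡ true
≢⇒not-== a≢b = cong not (≢⇒==-false a≢b)

𝟙 : Bool → ℕ
𝟙 b = if b then 1 else 0

count-cong : {f g : Fin n → Bool} → f ≗ g → count f ≡ count g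
count-cong {zero}  f≗g = refl
count-cong {suc n} f≗g = cong₂ _+_ (cong 𝟙 (f≗g zero)) (count-cong (f≗g ∘ suc))

count-mono : {f g : Fin n → Bool} → (∀ i → f i ≡ true → g i ≡ true) → count f ≤ count g
count-mono {zero}          f⊆g = z≤n
count-mono {suc n} {f} {g} f⊆g = +-mono-≤ (𝟙-mono (f zero) (g zero) (f⊆g zero)) (count-mono (f⊆g ∘ suc))
  where
  𝟙-mono : ∀ a b → (a ≡ true → b ≡ true) → 𝟙 a ≤ 𝟙 b
  𝟙-mono false _ _   = z≤n
  𝟙-mono true  b a⇒b rewrite a⇒b refl = ≤-refl

count-none : {f : Fin n → Bool} → (∀ i → f i ≡ false) → count f ≡ 0
count-none {zero}      none = refl
count-none {suc n} {f} none rewrite none zero = count-none (none ∘ suc)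

count-== : (a : Fin n) → count (_== a) ≡ 1
count-== {suc n} zero    = cong suc (count-none {n} {λ i → suc i == zero} λ _ → refl)
count-== {suc n} (suc a) = count-== a

count-split : (f g : Fin n → Bool) → count f ≡ count (λ i → f i ∧ g i) + count (λ i → f i ∧ not (g i))
count-split {zero}  f g = refl
count-split {suc n} f g rewrite count-split (f ∘ suc) (g ∘ suc) with f zero | g zero
... | false | _     = refl
... | true  | true  = refl
... | true  | false = sym (+-suc _ _)

count-remove : (f : Fin n → Bool) {a : Fin n} → f a ≡ true →
               count f ≡ suc (count (λ i → f i ∧ not (i == a)))
count-remove f {a} fa = begin
  count f                                                        ≡⟨ count-split f (_== a) ⟩
  count (λ i → f i ∧ (i == a)) + count (λ i → f i ∧ not (i == a)) ≡⟨ cong (_+ count (λ i → f i ∧ not (i == a))) (trans (count-cong at-a) (count-== a)) ⟩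
  suc (count (λ i → f i ∧ not (i == a)))                         ∎
  where
  open ≡-Reasoning
  at-a : ∀ i → (f i ∧ (i == a)) ≡ (i == a)
  at-a i with i ≟ a
  ... | yes refl = trans (∧-identityʳ (f i)) fa
  ... | no _     = ∧-zeroʳ (f i)

count≤length : {f : Fin n → Bool} (L : List (Fin n)) → (∀ i → f i ≡ true → i ∈ L) → count f ≤ length L
count≤length {f = f} []      ⊆L = ≤-reflexive (count-none none)
  where
  none : ∀ i → f i ≡ false
  none i with f i in fi
  ... | true  with () ← ⊆L i fi
  ... | false = refl
count≤length {f = f} (a ∷ L) ⊆L = begin
  count f                                                        ≡⟨ count-split f (_== a) ⟩
  count (λ i → f i ∧ (i == a)) + count (λ i → f i ∧ not (i == a)) ≤⟨ +-mono-≤ at-most-a (count≤length L ⊆L′) ⟩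
  suc (length L)                                                 ∎
  where
  open ≤-Reasoning
  at-most-a : count (λ i → f i ∧ (i == a)) ≤ 1
  at-most-a = ≤-trans (count-mono λ i → ∧-conicalʳ (f i) (i == a)) (≤-reflexive (count-== a))
  ⊆L′ : ∀ i → (f i ∧ not (i == a)) ≡ true → i ∈ L
  ⊆L′ i eq with ⊆L i (∧-conicalˡ _ _ eq)
  ... | here  i≡a = ⊥-elim (not-==⇒≢ (∧-conicalʳ _ _ eq) i≡a)
  ... | there i∈L = i∈L

length≤count : {f : Fin n → Bool} (L : List (Fin n)) → Unique L → All (λ i → f i ≡ true) L → length L ≤ count f
length≤count             []      _              _           = z≤n
length≤count {f = f} (a ∷ L) (a∉L ∷ uniq) (fa ∷ fL) rewrite count-remove f fa =
  s≤s (length≤count L uniq (All.zipWith keep (a∉L , fL)))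
  where
  keep : ∀ {i} → a ≢ i × f i ≡ true → (f i ∧ not (i == a)) ≡ true
  keep (a≢i , fi) rewrite fi | ≢⇒==-false (a≢i ∘ sym) = refl

injective⇒≤count : {f : Fin n → Bool} (g : Fin k → Fin n) → (∀ {i j} → g i ≡ g j → i ≡ j) →
                   (∀ i → f (g i) ≡ true) → k ≤ count f
injective⇒≤count g g-injective fg =
  subst (_≤ _) (length-tabulate g) (length≤count (List.tabulate g) (Unique.tabulate⁺ g-injective) (tabulate⁺ fg))

count>length⇒∃∉ : {f : Fin n → Bool} (L : List (Fin n)) → length L < count f → ∃ λ i → f i ≡ true × i ∉ L
count>length⇒∃∉ {f = f} L L<f with any? (λ i → (f i ≟ᵇ true) ×-dec ¬? (Any.any? (i ≟_) L))
... | yes found = found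
... | no  none  = ⊥-elim (<⇒≱ L<f (count≤length L ⊆L))
  where
  ⊆L : ∀ i → f i ≡ true → i ∈ L
  ⊆L i fi = decidable-stable (Any.any? (i ≟_) L) (λ i∉L → none (i , fi , i∉L))

count≡1⇒unique : {f : Fin n → Bool} → count f ≡ 1 → ∃ λ a → f a ≡ true × ∀ b → f b ≡ true → b ≡ a
count≡1⇒unique {f = f} one with count>length⇒∃∉ [] (≤-reflexive (sym one))
... | a , fa , _ = a , fa , unique
  where
  unique : ∀ b → f b ≡ true → b ≡ a
  unique b fb with b ≟ a
  ... | yes b≡a = b≡a
  ... | no  b≢a = ⊥-elim (<-irrefl (sym one) (length≤count (a ∷ b ∷ []) (((b≢a ∘ sym) ∷ []) ∷ [] ∷ []) (fa ∷ fb ∷ [])))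

sumFin≡sum : (f : Fin n → ℕ) → sumFin f ≡ sum f
sumFin≡sum {zero}  f = refl
sumFin≡sum {suc n} f = cong (f zero +_) (sumFin≡sum (f ∘ suc))

count≡sum : (f : Fin n → Bool) → count f ≡ sum (𝟙 ∘ f)
count≡sum {zero}  f = refl
count≡sum {suc n} f = cong (𝟙 (f zero) +_) (count≡sum (f ∘ suc))

sum-bound : {f : Fin n → ℕ} (c : ℕ) → (∀ i → f i ≤ c) → sum f ≤ n * c
sum-bound {zero}  c f≤c = z≤n
sum-bound {suc n} c f≤c = +-mono-≤ (f≤c zero) (sum-bound c (f≤c ∘ suc))

infix 4 _≺_
_≺_ : Fin n → Fin n → Bool
u ≺ v = toℕ u <ᵇ toℕ v

≺-false⇒≥ : {u v : Fin n} → (u ≺ v) ≡ false → toℕ v ≤ toℕ u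
≺-false⇒≥ u⊀v = ≮⇒≥ (λ u<v → subst T u⊀v (<⇒<ᵇ u<v))

≺-true⇒< : {u v : Fin n} → (u ≺ v) ≡ true → toℕ u < toℕ v
≺-true⇒< {u = u} {v} u≺v = <ᵇ⇒< (toℕ u) (toℕ v) (subst T (sym u≺v) tt)

𝟙-split : (D : Fin n → Fin n → Bool) → (∀ u → D u u ≡ false) →
          ∀ u v → 𝟙 (D u v) ≡ 𝟙 ((u ≺ v) ∧ D u v) + 𝟙 ((v ≺ u) ∧ D u v)
𝟙-split D D-irr u v with D u v in uv | u ≺ v in u≺v | v ≺ u in v≺u
... | true  | true  | true  = ⊥-elim (<-asym (≺-true⇒< {u = u} {v} u≺v) (≺-true⇒< {u = v} {u} v≺u))
... | true  | true  | false = refl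
... | true  | false | true  = refl
... | true  | false | false
  with () ← trans (sym uv) (subst (λ w → D u w ≡ false) (toℕ-injective (≤-antisym (≺-false⇒≥ {u = v} {u} v≺u) (≺-false⇒≥ {u = u} {v} u≺v))) (D-irr u))
𝟙-split D D-irr u v | false | false | false = refl
𝟙-split D D-irr u v | false | false | true  = refl
𝟙-split D D-irr u v | false | true  | false = refl
𝟙-split D D-irr u v | false | true  | true  = refl

pairCount : (Fin n → Fin n → Bool) → ℕ
pairCount D = sumFin (λ u → count (λ v → (u ≺ v) ∧ D u v))

handshake : (D : Fin n → Fin n → Bool) → (∀ u v → D u v ≡ D v u) → (∀ u → D u u ≡ false) →
            sumFin (λ u → count (D u)) ≡ pairCount D + pairCount D
handshake D D-sym D-irr = begin
  sumFin (count ∘ D)                          ≡⟨ trans (sumFin≡sum (count ∘ D)) (sum-cong-≗ (count≡sum ∘ D)) ⟩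
  sum (λ u → sum (λ v → 𝟙 (D u v)))           ≡⟨ sum-cong-≗ (λ u → trans (sum-cong-≗ (𝟙-split D D-irr u)) (∑-distrib-+ (forward u) (backward u))) ⟩
  sum (λ u → sum (forward u) + sum (backward u)) ≡⟨ ∑-distrib-+ (sum ∘ forward) (sum ∘ backward) ⟩
  P + sum (sum ∘ backward)                    ≡⟨ cong (P +_) (trans (∑-comm backward) (sum-cong-≗ λ v → sum-cong-≗ λ u → cong (λ b → 𝟙 ((v ≺ u) ∧ b)) (D-sym u v))) ⟩
  P + P                                       ≡⟨ cong₂ _+_ (sym pairCount≡P) (sym pairCount≡P) ⟩
  pairCount D + pairCount D                   ∎
  where
  open ≡-Reasoning
  forward backward : Fin _ → Fin _ → ℕ
  forward  u v = 𝟙 ((u ≺ v) ∧ D u v)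
  backward u v = 𝟙 ((v ≺ u) ∧ D u v)
  P = sum (sum ∘ forward)
  pairCount≡P : pairCount D ≡ P
  pairCount≡P = trans (sumFin≡sum (λ u → count (λ v → (u ≺ v) ∧ D u v))) (sum-cong-≗ λ u → count≡sum (λ v → (u ≺ v) ∧ D u v))

count-xor : (a b : Fin n) → count (λ v → (v == a) xor (v == b)) ≡ 𝟙 (not (a == b)) + 𝟙 (not (a == b))
count-xor {suc n} zero    zero    = count-none {n} {λ _ → false} λ _ → refl
count-xor {suc n} zero    (suc b) = cong suc (count-== b)
count-xor {suc n} (suc a) zero    = cong suc (trans (count-cong (xor-identityʳ ∘ (_== a))) (count-== a))
count-xor {suc n} (suc a) (suc b) = count-xor a b

-- Perfect matchings as fixed-point-free involutions

module _ {G : Graph n} where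

  private
    mate-spec : (X : PerfectMatching G) (u : Fin n) →
                ∃ λ a → edge X u a ≡ true × ∀ b → edge X u b ≡ true → b ≡ a
    mate-spec X u = count≡1⇒unique (perfect X u)

  -- Opaque: mate is only used through mate-edge and edge⇒≡mate, and letting Agda unfold
  -- it makes conversion checking on nested mates prohibitively slow.
  opaque

    mate : PerfectMatching G → Fin n → Fin n
    mate X u = proj₁ (mate-spec X u)

    mate-edge : (X : PerfectMatching G) → ∀ u → edge X u (mate X u) ≡ true
    mate-edge X u = proj₁ (proj₂ (mate-spec X u))

    edge⇒≡mate : (X : PerfectMatching G) → ∀ {u v} → edge X u v ≡ true → v ≡ mate X u
    edge⇒≡mate X {u} {v} = proj₂ (proj₂ (mate-spec X u)) v

  module _ (X : PerfectMatching G) where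

    edge≡mate : ∀ u v → edge X u v ≡ (v == mate X u)
    edge≡mate u v with edge X u v in uv | v ≟ mate X u
    ... | true  | yes _    = refl
    ... | true  | no  v≢m  = ⊥-elim (v≢m (edge⇒≡mate X uv))
    ... | false | yes refl = trans (sym uv) (mate-edge X u)
    ... | false | no  _    = refl

    mate-involutive : ∀ u → mate X (mate X u) ≡ u
    mate-involutive u = sym (edge⇒≡mate X (trans (edgeSym X (mate X u) u) (mate-edge X u)))

    mate-swap : ∀ {u v} → u ≡ mate X v → v ≡ mate X u
    mate-swap {u} {v} eq = trans (sym (mate-involutive v)) (cong (mate X) (sym eq))

    mate-injective : ∀ {u v} → mate X u ≡ mate X v → u ≡ v
    mate-injective {u} {v} eq = trans (sym (mate-involutive u)) (trans (cong (mate X) eq) (mate-involutive v))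

    mate-adj : ∀ u → adj G u (mate X u) ≡ true
    mate-adj u = sub X u (mate X u) (mate-edge X u)

    mate≢ : ∀ u → mate X u ≢ u
    mate≢ u eq with () ← trans (sym (subst (λ w → adj G u w ≡ true) eq (mate-adj u))) (irrefl G u)

  -- Each vertex whose mates differ lies on exactly two edges of M Δ M', the others on none.
  symDiffSize≡count-differ : (X Y : PerfectMatching G) → symDiffSize X Y ≡ count (λ u → not (mate X u == mate Y u))
  symDiffSize≡count-differ X Y = halve (begin
    symDiffSize X Y + symDiffSize X Y      ≡⟨ sym (handshake D D-sym D-irr) ⟩
    sumFin (λ u → count (D u))             ≡⟨ trans (sumFin≡sum (count ∘ D)) (sum-cong-≗ D-degree) ⟩
    sum (λ u → 𝟙 (differ u) + 𝟙 (differ u)) ≡⟨ ∑-distrib-+ (𝟙 ∘ differ) (𝟙 ∘ differ) ⟩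
    sum (𝟙 ∘ differ) + sum (𝟙 ∘ differ)   ≡⟨ cong₂ _+_ (sym (count≡sum differ)) (sym (count≡sum differ)) ⟩
    count differ + count differ            ∎)
    where
    open ≡-Reasoning
    D : Fin n → Fin n → Bool
    D u v = edge X u v xor edge Y u v
    D-sym : ∀ u v → D u v ≡ D v u
    D-sym u v = cong₂ _xor_ (edgeSym X u v) (edgeSym Y u v)
    D-irr : ∀ u → D u u ≡ false
    D-irr u rewrite edge≡mate X u u | edge≡mate Y u u
      | ≢⇒==-false (mate≢ X u ∘ sym) | ≢⇒==-false (mate≢ Y u ∘ sym) = refl
    differ : Fin n → Bool
    differ u = not (mate X u == mate Y u)
    D-degree : ∀ u → count (D u) ≡ 𝟙 (differ u) + 𝟙 (differ u)
    D-degree u = trans (count-cong (λ v → cong₂ _xor_ (edge≡mate X u v) (edge≡mate Y u v))) (count-xor (mate X u) (mate Y u))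
    halve : ∀ {a b} → a + a ≡ b + b → a ≡ b
    halve {a} {b} eq = trans (n≡⌊n+n/2⌋ a) (trans (cong ⌊_/2⌋ eq) (sym (n≡⌊n+n/2⌋ b)))

  fromInvolution : (μ : Fin n → Fin n) → (∀ u → μ (μ u) ≡ u) → (∀ u → adj G u (μ u) ≡ true) → PerfectMatching G
  fromInvolution μ μ-inv μ-adj = record
    { edge    = λ u v → v == μ u
    ; edgeSym = sym-==
    ; sub     = λ u v eq → subst (λ w → adj G u w ≡ true) (sym (==⇒≡ eq)) (μ-adj u)
    ; perfect = λ u → count-== (μ u)
    }
    where
    sym-== : ∀ u v → (v == μ u) ≡ (u == μ v)
    sym-== u v with v ≟ μ u | u ≟ μ v
    ... | yes _    | yes _    = refl
    ... | yes refl | no  u≢μv = ⊥-elim (u≢μv (sym (μ-inv u)))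
    ... | no  v≢μu | yes refl = ⊥-elim (v≢μu (sym (μ-inv v)))
    ... | no  _    | no  _    = refl

  mate-fromInvolution : ∀ μ μ-inv μ-adj u → mate (fromInvolution μ μ-inv μ-adj) u ≡ μ u
  mate-fromInvolution μ μ-inv μ-adj u = sym (edge⇒≡mate (fromInvolution μ μ-inv μ-adj) (==-refl (μ u)))

-- Local switch paths, decided by evaluation

localGraph : (p p' : Fin k → Fin k) → (Fin k → Fin k → Bool) → Fin k → Fin k → Bool
localGraph p p' extra i j = (j == p i) ∨ (j == p' i) ∨ extra i j

IsLocalMatching : (Fin k → Fin k → Bool) → (Fin k → Fin k) → Set
IsLocalMatching A q = ∀ i → q (q i) ≡ i × A i (q i) ≡ true

isLocalMatching? : (A : Fin k → Fin k → Bool) → Decidable (IsLocalMatching A)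
isLocalMatching? A q = all? λ i → (q (q i) ≟ i) ×-dec (A i (q i) ≟ᵇ true)

differingPositions : (Fin k → Fin k) → (Fin k → Fin k) → List (Fin k)
differingPositions q r = filter (λ i → ¬? (q i ≟ r i)) (allFin _)

distance : (Fin k → Fin k) → (Fin k → Fin k) → ℕ
distance q r = length (differingPositions q r)

SwitchPath : (Fin k → Fin k → Bool) → (q p' : Fin k → Fin k) → List (Fin k → Fin k) → Set
SwitchPath A q p' []       = distance q p' ≤ 4
SwitchPath A q p' (r ∷ rs) = distance q r ≤ 4 × IsLocalMatching A r × SwitchPath A r p' rs

switchPath? : (A : Fin k → Fin k → Bool) (q p' : Fin k → Fin k) → Decidable (SwitchPath A q p')
switchPath? A q p' []       = distance q p' ≤? 4
switchPath? A q p' (r ∷ rs) = distance q r ≤? 4 ×-dec isLocalMatching? A r ×-dec switchPath? A r p' rs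

SwitchableVia : List (List (Fin k → Fin k)) → (p p' : Fin k → Fin k) → (Fin k → Fin k → Bool) → Set
SwitchableVia paths p p' extra = Any (SwitchPath (localGraph p p' extra) p p') paths

switchableVia? : ∀ paths (p p' : Fin k → Fin k) extra → Dec (SwitchableVia paths p p' extra)
switchableVia? paths p p' extra = Any.any? (switchPath? (localGraph p p' extra) p p') paths

-- Together with from-yes this proves a decidable statement about all 2ᵏ bit vectors by
-- evaluation.
all-bits? : {P : Vec Bool k → Set} → Decidable P → Dec (∀ bs → P bs)
all-bits? {zero}  P? = map′ (λ p → nil p) (λ all → all []) (P? [])
  where
  nil : ∀ {P : Vec Bool 0 → Set} → P [] → ∀ bs → P bs
  nil p [] = p
all-bits? {suc k} P? = map′ (uncurry cons) (λ all → all ∘ (true ∷_) , all ∘ (false ∷_))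
                              (all-bits? (P? ∘ (true ∷_)) ×-dec all-bits? (P? ∘ (false ∷_)))
  where
  cons : ∀ {P : Vec Bool (suc k) → Set} → (∀ bs → P (true ∷ bs)) → (∀ bs → P (false ∷ bs)) → ∀ bs → P bs
  cons t f (true  ∷ bs) = t bs
  cons t f (false ∷ bs) = f bs

-- The hexagon c₀ … c₅ carries M = {c₀c₁, c₂c₃, c₄c₅} and M' = {c₁c₂, c₃c₄, c₅c₀}; the bits
-- ds of diagonals ds record which of the long diagonals c₀c₃, c₁c₄, c₂c₅ are edges.
hexM hexM' opposite : Fin 6 → Fin 6
hexM     = lookup (1F ∷ 0F ∷ 3F ∷ 2F ∷ 5F ∷ 4F ∷ [])
hexM'    = lookup (5F ∷ 2F ∷ 1F ∷ 4F ∷ 3F ∷ 0F ∷ [])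
opposite = lookup (3F ∷ 4F ∷ 5F ∷ 0F ∷ 1F ∷ 2F ∷ [])

opposite-≢ : ∀ i → i ≢ opposite i
opposite-≢ 0F ()
opposite-≢ 1F ()
opposite-≢ 2F ()
opposite-≢ 3F ()
opposite-≢ 4F ()
opposite-≢ 5F ()

axis : Fin 6 → Fin 3
axis = lookup (0F ∷ 1F ∷ 2F ∷ 0F ∷ 1F ∷ 2F ∷ [])

isEven : Fin 6 → Bool
isEven = lookup (true ∷ false ∷ true ∷ false ∷ true ∷ false ∷ [])

isEven-opposite : ∀ i → isEven (opposite i) ≡ not (isEven i)
isEven-opposite 0F = refl
isEven-opposite 1F = refl
isEven-opposite 2F = refl
isEven-opposite 3F = refl
isEven-opposite 4F = refl
isEven-opposite 5F = refl

count-non-opposite : ∀ i → count (λ j → not (j == i) ∧ not (j == opposite i)) ≡ 4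
count-non-opposite 0F = refl
count-non-opposite 1F = refl
count-non-opposite 2F = refl
count-non-opposite 3F = refl
count-non-opposite 4F = refl
count-non-opposite 5F = refl

count-other-parity-non-opposite : ∀ i → count (λ j → not (does (isEven j ≟ᵇ isEven i)) ∧ not (j == opposite i)) ≡ 2
count-other-parity-non-opposite 0F = refl
count-other-parity-non-opposite 1F = refl
count-other-parity-non-opposite 2F = refl
count-other-parity-non-opposite 3F = refl
count-other-parity-non-opposite 4F = refl
count-other-parity-non-opposite 5F = refl

diagonals : Vec Bool 3 → Fin 6 → Fin 6 → Bool
diagonals ds i j = (j == opposite i) ∧ lookup ds (axis i)

hexagonPaths : List (List (Fin 6 → Fin 6))
hexagonPaths = (lookup (3F ∷ 2F ∷ 1F ∷ 0F ∷ 5F ∷ 4F ∷ []) ∷ [])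
             ∷ (lookup (5F ∷ 4F ∷ 3F ∷ 2F ∷ 1F ∷ 0F ∷ []) ∷ [])
             ∷ (lookup (1F ∷ 0F ∷ 5F ∷ 4F ∷ 3F ∷ 2F ∷ []) ∷ [])
             ∷ []

hexagon-switchable : ∀ ds → (∃ λ a → lookup ds a ≡ true) → SwitchableVia hexagonPaths hexM hexM' (diagonals ds)
hexagon-switchable = from-yes $ all-bits? λ ds →
  any? (λ a → lookup ds a ≟ᵇ true) →-dec switchableVia? hexagonPaths hexM hexM' (diagonals ds)

-- The octagon puts an M-edge xy at positions 0 and 1 in front of the hexagon; the bits bx
-- and by of attach bx by record which hexagon vertices x and y are adjacent to.
extendByEdge : (Fin k → Fin k) → Fin (2 + k) → Fin (2 + k)
extendByEdge p 0F            = 1F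
extendByEdge p 1F            = 0F
extendByEdge p (suc (suc i)) = suc (suc (p i))

attach : Vec Bool k → Vec Bool k → Fin (2 + k) → Fin (2 + k) → Bool
attach bx by 0F            (suc (suc j)) = lookup bx j
attach bx by 1F            (suc (suc j)) = lookup by j
attach bx by (suc (suc i)) 0F            = lookup bx i
attach bx by (suc (suc i)) 1F            = lookup by i
attach bx by _             _             = false

weight : Vec Bool k → ℕ
weight bs = count (lookup bs)

octagonPaths : List (List (Fin 8 → Fin 8))
octagonPaths =
    (lookup (6F ∷ 7F ∷ 3F ∷ 2F ∷ 5F ∷ 4F ∷ 0F ∷ 1F ∷ [])
     ∷ lookup (4F ∷ 7F ∷ 3F ∷ 2F ∷ 0F ∷ 6F ∷ 5F ∷ 1F ∷ [])
     ∷ lookup (4F ∷ 3F ∷ 7F ∷ 1F ∷ 0F ∷ 6F ∷ 5F ∷ 2F ∷ []) ∷ [])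
  ∷ (lookup (7F ∷ 6F ∷ 3F ∷ 2F ∷ 5F ∷ 4F ∷ 1F ∷ 0F ∷ [])
     ∷ lookup (7F ∷ 4F ∷ 3F ∷ 2F ∷ 1F ∷ 6F ∷ 5F ∷ 0F ∷ [])
     ∷ lookup (3F ∷ 4F ∷ 7F ∷ 0F ∷ 1F ∷ 6F ∷ 5F ∷ 2F ∷ []) ∷ [])
  ∷ (lookup (4F ∷ 5F ∷ 3F ∷ 2F ∷ 0F ∷ 1F ∷ 7F ∷ 6F ∷ [])
     ∷ lookup (4F ∷ 7F ∷ 3F ∷ 2F ∷ 0F ∷ 6F ∷ 5F ∷ 1F ∷ [])
     ∷ lookup (2F ∷ 7F ∷ 0F ∷ 4F ∷ 3F ∷ 6F ∷ 5F ∷ 1F ∷ []) ∷ [])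
  ∷ (lookup (2F ∷ 3F ∷ 0F ∷ 1F ∷ 5F ∷ 4F ∷ 7F ∷ 6F ∷ [])
     ∷ lookup (6F ∷ 3F ∷ 7F ∷ 1F ∷ 5F ∷ 4F ∷ 0F ∷ 2F ∷ [])
     ∷ lookup (6F ∷ 5F ∷ 7F ∷ 4F ∷ 3F ∷ 1F ∷ 0F ∷ 2F ∷ []) ∷ [])
  ∷ (lookup (5F ∷ 4F ∷ 3F ∷ 2F ∷ 1F ∷ 0F ∷ 7F ∷ 6F ∷ [])
     ∷ lookup (7F ∷ 4F ∷ 3F ∷ 2F ∷ 1F ∷ 6F ∷ 5F ∷ 0F ∷ [])
     ∷ lookup (7F ∷ 2F ∷ 1F ∷ 4F ∷ 3F ∷ 6F ∷ 5F ∷ 0F ∷ []) ∷ [])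
  ∷ (lookup (3F ∷ 2F ∷ 1F ∷ 0F ∷ 5F ∷ 4F ∷ 7F ∷ 6F ∷ [])
     ∷ lookup (3F ∷ 6F ∷ 7F ∷ 0F ∷ 5F ∷ 4F ∷ 1F ∷ 2F ∷ [])
     ∷ lookup (5F ∷ 6F ∷ 7F ∷ 4F ∷ 3F ∷ 0F ∷ 1F ∷ 2F ∷ []) ∷ [])
  ∷ []

OctagonSwitchable : Vec Bool 6 → Vec Bool 6 → Set
OctagonSwitchable bx by = SwitchableVia octagonPaths (extendByEdge hexM) (extendByEdge hexM') (attach bx by)

octagonSwitchable? : ∀ bx by → Dec (OctagonSwitchable bx by)
octagonSwitchable? bx by = switchableVia? octagonPaths (extendByEdge hexM) (extendByEdge hexM') (attach bx by)

dense-octagon-switchable : ∀ bx by → 9 ≤ weight bx + weight by → OctagonSwitchable bx by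
dense-octagon-switchable = from-yes $ all-bits? λ bx → all-bits? λ by →
  9 ≤? weight bx + weight by →-dec octagonSwitchable? bx by

bipartite-octagon-switchable : ∀ bx by → (∀ i → lookup bx i ≡ true → isEven i ≡ true) →
                               (∀ i → lookup by i ≡ true → isEven i ≡ false) →
                               5 ≤ weight bx + weight by → OctagonSwitchable bx by
bipartite-octagon-switchable = from-yes $ all-bits? λ bx → all-bits? λ by →
  all? (λ i → (lookup bx i ≟ᵇ true) →-dec (isEven i ≟ᵇ true)) →-dec
  all? (λ i → (lookup by i ≟ᵇ true) →-dec (isEven i ≟ᵇ false)) →-dec
  5 ≤? weight bx + weight by →-dec octagonSwitchable? bx by

module _ {G : Graph n} (M M' : PerfectMatching G) where

  record Window (k : ℕ) (p p' : Fin k → Fin k) : Set where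
    field
      vertex           : Fin k → Fin n
      vertex-injective : ∀ {i j} → vertex i ≡ vertex j → i ≡ j
      mate-vertex      : ∀ i → mate M (vertex i) ≡ vertex (p i)
      mate'-vertex     : ∀ i → mate M' (vertex i) ≡ vertex (p' i)
      agree-outside    : ∀ u → (∀ i → vertex i ≢ u) → mate M u ≡ mate M' u

    Outside : Fin n → Set
    Outside u = ∀ i → vertex i ≢ u

    locate : ∀ u → (∃ λ i → vertex i ≡ u) ⊎ Outside u
    locate u with any? (λ i → vertex i ≟ u)
    ... | yes inside = inj₁ inside
    ... | no  ¬found = inj₂ (λ i eq → ¬found (i , eq))

    by-location : {P : Fin n → Set} → (∀ i → P (vertex i)) → (∀ {u} → Outside u → P u) → ∀ u → P u
    by-location inside outside u with locate u
    ... | inj₁ (i , refl) = inside i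
    ... | inj₂ out        = outside out

    adj-p : ∀ i → adj G (vertex i) (vertex (p i)) ≡ true
    adj-p i = subst (λ w → adj G (vertex i) w ≡ true) (mate-vertex i) (mate-adj M (vertex i))

    adj-p' : ∀ i → adj G (vertex i) (vertex (p' i)) ≡ true
    adj-p' i = subst (λ w → adj G (vertex i) w ≡ true) (mate'-vertex i) (mate-adj M' (vertex i))

    degIn : Fin n → ℕ
    degIn u = count (λ i → adj G u (vertex i))

    neighbourBits : Fin n → Vec Bool k
    neighbourBits u = tabulate (λ i → adj G u (vertex i))

    weight-neighbourBits : ∀ u → weight (neighbourBits u) ≡ degIn u
    weight-neighbourBits u = count-cong (lookup∘tabulate (λ i → adj G u (vertex i)))

    mate-outside : ∀ {u} → Outside u → Outside (mate M u)
    mate-outside {u} out i eq =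
      out (p i) (trans (sym (mate-vertex i)) (trans (cong (mate M) eq) (mate-involutive M u)))

  module Switching {k p p'} (W : Window k p p') (extra : Fin k → Fin k → Bool)
                   (extra-sound : ∀ i j → extra i j ≡ true → adj G (Window.vertex W i) (Window.vertex W j) ≡ true) where

    open Window W

    A : Fin k → Fin k → Bool
    A = localGraph p p' extra

    A-sound : ∀ i j → A i j ≡ true → adj G (vertex i) (vertex j) ≡ true
    A-sound i j eq with j ≟ p i | j ≟ p' i
    ... | yes refl | _        = adj-p i
    ... | no  _    | yes refl = adj-p' i
    ... | no  _    | no  _    = extra-sound i j eq

    switch : (Fin k → Fin k) → Fin n → Fin n
    switch q u with locate u
    ... | inj₁ (i , _) = vertex (q i)
    ... | inj₂ _       = mate M u

    switch-vertex : ∀ q i → switch q (vertex i) ≡ vertex (q i)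
    switch-vertex q i with locate (vertex i)
    ... | inj₁ (j , eq) = cong (vertex ∘ q) (vertex-injective eq)
    ... | inj₂ out      = ⊥-elim (out i refl)

    switch-outside : ∀ q {u} → Outside u → switch q u ≡ mate M u
    switch-outside q {u} out with locate u
    ... | inj₁ (i , eq) = ⊥-elim (out i eq)
    ... | inj₂ _        = refl

    module _ (q : Fin k → Fin k) (q-matching : IsLocalMatching A q) where

      switch-involutive : ∀ u → switch q (switch q u) ≡ u
      switch-involutive = by-location inside outside
        where
        open ≡-Reasoning
        inside : ∀ i → switch q (switch q (vertex i)) ≡ vertex i
        inside i = begin
          switch q (switch q (vertex i)) ≡⟨ cong (switch q) (switch-vertex q i) ⟩
          switch q (vertex (q i))        ≡⟨ switch-vertex q (q i) ⟩
          vertex (q (q i))               ≡⟨ cong vertex (proj₁ (q-matching i)) ⟩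
          vertex i                       ∎
        outside : ∀ {u} → Outside u → switch q (switch q u) ≡ u
        outside {u} out = begin
          switch q (switch q u)  ≡⟨ cong (switch q) (switch-outside q out) ⟩
          switch q (mate M u)    ≡⟨ switch-outside q (mate-outside out) ⟩
          mate M (mate M u)      ≡⟨ mate-involutive M u ⟩
          u                      ∎

      switch-adj : ∀ u → adj G u (switch q u) ≡ true
      switch-adj = by-location
        (λ i → subst (λ w → adj G (vertex i) w ≡ true) (sym (switch-vertex q i)) (A-sound i (q i) (proj₂ (q-matching i))))
        (λ {u} out → subst (λ w → adj G u w ≡ true) (sym (switch-outside q out)) (mate-adj M u))

      globalize : PerfectMatching G
      globalize = fromInvolution (switch q) switch-involutive switch-adj

    _Realizes_ : PerfectMatching G → (Fin k → Fin k) → Set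
    X Realizes q = ∀ u → mate X u ≡ switch q u

    M-realizes : M Realizes p
    M-realizes = by-location
      (λ i → trans (mate-vertex i) (sym (switch-vertex p i)))
      (λ out → sym (switch-outside p out))

    M'-realizes : M' Realizes p'
    M'-realizes = by-location
      (λ i → trans (mate'-vertex i) (sym (switch-vertex p' i)))
      (λ {u} out → trans (sym (agree-outside u out)) (sym (switch-outside p' out)))

    globalize-realizes : ∀ q (q-matching : IsLocalMatching A q) → globalize q q-matching Realizes q
    globalize-realizes q q-matching = mate-fromInvolution {G = G} (switch q) (switch-involutive q q-matching) (switch-adj q q-matching)

    symDiffSize≤distance : ∀ {X Y q r} → X Realizes q → Y Realizes r → symDiffSize X Y ≤ distance q r
    symDiffSize≤distance {X} {Y} {q} {r} X≈q Y≈r = begin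
      symDiffSize X Y                                  ≡⟨ symDiffSize≡count-differ X Y ⟩
      count (λ u → not (mate X u == mate Y u))         ≤⟨ count≤length (map vertex (differingPositions q r)) differing⊆ ⟩
      length (map vertex (differingPositions q r))     ≡⟨ length-map vertex (differingPositions q r) ⟩
      distance q r                                     ∎
      where
      open ≤-Reasoning
      differing⊆ : ∀ u → not (mate X u == mate Y u) ≡ true → u ∈ map vertex (differingPositions q r)
      differing⊆ = by-location
        (λ i differ → ∈-map⁺ vertex (∈-filter⁺ (λ i → ¬? (q i ≟ r i)) (∈-allFin i) λ qi≡ri →
           not-==⇒≢ differ (trans (X≈q (vertex i)) (trans (switch-vertex q i)
             (trans (cong vertex qi≡ri) (sym (trans (Y≈r (vertex i)) (switch-vertex r i))))))))
        (λ {u} out differ → ⊥-elim (not-==⇒≢ differ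
           (trans (X≈q u) (trans (switch-outside q out) (sym (trans (Y≈r u) (switch-outside r out)))))))

    path⇒equiv : ∀ {X q} rs → X Realizes q → SwitchPath A q p' rs → Equiv2Switch X M'
    path⇒equiv {X} {q} [] X≈q q~p' = X~M' ◅ ε
      where
      X~M' : TwoSwitch X M'
      X~M' = ≤-trans (symDiffSize≤distance {X} {M'} {q} {p'} X≈q M'-realizes) q~p'
    path⇒equiv {X} {q} (r ∷ rs) X≈q (q~r , r-matching , r~p') = X~N ◅ path⇒equiv {N} {r} rs N≈r r~p'
      where
      N : PerfectMatching G
      N = globalize r r-matching
      N≈r : N Realizes r
      N≈r = globalize-realizes r r-matching
      X~N : TwoSwitch X N
      X~N = ≤-trans (symDiffSize≤distance {X} {N} {q} {r} X≈q N≈r) q~r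

    switchable⇒equiv : ∀ {paths} → SwitchableVia paths p p' extra → Equiv2Switch M M'
    switchable⇒equiv switchable with Any.satisfied switchable
    ... | rs , path = path⇒equiv {M} {p} rs M-realizes path

  module Extension {k p p'} (W : Window k p p') (x : Fin n) (x-out : Window.Outside W x) where

    open Window W

    private
      m : Fin n → Fin n
      m = mate M

    vertex⁺ : Fin (2 + k) → Fin n
    vertex⁺ 0F            = x
    vertex⁺ 1F            = m x
    vertex⁺ (suc (suc i)) = vertex i

    vertex⁺-injective : ∀ {i j} → vertex⁺ i ≡ vertex⁺ j → i ≡ j
    vertex⁺-injective {0F}          {0F}          _  = refl
    vertex⁺-injective {0F}          {1F}          eq = ⊥-elim (mate≢ M x (sym eq))
    vertex⁺-injective {0F}          {suc (suc j)} eq = ⊥-elim (x-out j (sym eq))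
    vertex⁺-injective {1F}          {0F}          eq = ⊥-elim (mate≢ M x eq)
    vertex⁺-injective {1F}          {1F}          _  = refl
    vertex⁺-injective {1F}          {suc (suc j)} eq = ⊥-elim (mate-outside x-out j (sym eq))
    vertex⁺-injective {suc (suc i)} {0F}          eq = ⊥-elim (x-out i eq)
    vertex⁺-injective {suc (suc i)} {1F}          eq = ⊥-elim (mate-outside x-out i eq)
    vertex⁺-injective {suc (suc i)} {suc (suc j)} eq = cong (λ i → Data.Fin.suc (suc i)) (vertex-injective eq)

    extended : Window (2 + k) (extendByEdge p) (extendByEdge p')
    extended = record
      { vertex           = vertex⁺
      ; vertex-injective = vertex⁺-injective
      ; mate-vertex      = mate-vertex⁺
      ; mate'-vertex     = mate'-vertex⁺
      ; agree-outside    = λ u out → agree-outside u (λ i → out (suc (suc i)))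
      }
      where
      mate-vertex⁺ : ∀ i → m (vertex⁺ i) ≡ vertex⁺ (extendByEdge p i)
      mate-vertex⁺ 0F            = refl
      mate-vertex⁺ 1F            = mate-involutive M x
      mate-vertex⁺ (suc (suc i)) = mate-vertex i
      mate'-vertex⁺ : ∀ i → mate M' (vertex⁺ i) ≡ vertex⁺ (extendByEdge p' i)
      mate'-vertex⁺ 0F            = sym (agree-outside x x-out)
      mate'-vertex⁺ 1F            = trans (sym (agree-outside (m x) (mate-outside x-out))) (mate-involutive M x)
      mate'-vertex⁺ (suc (suc i)) = mate'-vertex i

    attach-sound : ∀ i j → attach (neighbourBits x) (neighbourBits (m x)) i j ≡ true → adj G (vertex⁺ i) (vertex⁺ j) ≡ true
    attach-sound 0F            (suc (suc j)) eq = trans (sym (lookup∘tabulate _ j)) eq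
    attach-sound 1F            (suc (suc j)) eq = trans (sym (lookup∘tabulate _ j)) eq
    attach-sound (suc (suc i)) 0F            eq = trans (adj-sym G (vertex i) x) (trans (sym (lookup∘tabulate _ i)) eq)
    attach-sound (suc (suc i)) 1F            eq = trans (adj-sym G (vertex i) (m x)) (trans (sym (lookup∘tabulate _ i)) eq)
    attach-sound 0F            0F            ()
    attach-sound 0F            1F            ()
    attach-sound 1F            0F            ()
    attach-sound 1F            1F            ()
    attach-sound (suc (suc i)) (suc (suc j)) ()

-- The symmetric difference is a hexagon

Hexagon : {G : Graph n} → PerfectMatching G → PerfectMatching G → Set
Hexagon M M' = Window M M' 6 hexM hexM'

module Structure {G : Graph n} (M M' : PerfectMatching G) (≤6 : symDiffSize M M' ≤ 6) where

  private
    m m' : Fin n → Fin n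
    m  = mate M
    m' = mate M'

  Differs : Fin n → Set
  Differs u = m u ≢ m' u

  differs-m : ∀ {u} → Differs u → Differs (m u)
  differs-m {u} du eq = du (mate-swap M' (trans (sym (mate-involutive M u)) eq))

  differs-m' : ∀ {u} → Differs u → Differs (m' u)
  differs-m' {u} du eq = du (sym (mate-swap M (sym (trans eq (mate-involutive M' u)))))

  differing≤6 : ∀ {k} (xs : Vec (Fin n) k) → Vec.Unique xs → VecAll.All Differs xs → k ≤ 6
  differing≤6 {k} xs unique differs = begin
    k                                   ≤⟨ injective⇒≤count (lookup xs) (λ {i} {j} → lookup-injective unique i j) (≢⇒not-== ∘ lookup⁺ differs) ⟩
    count (λ u → not (m u == m' u))     ≡⟨ symDiffSize≡count-differ M M' ⟨
    symDiffSize M M'                    ≤⟨ ≤6 ⟩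
    6                                   ∎
    where open ≤-Reasoning

  fresh≤6 : ∀ {k u} (xs : Vec (Fin n) k) → Vec.Unique xs → VecAll.All Differs xs →
            VecAll.All (_≢ u) xs → Differs u → suc k ≤ 6
  fresh≤6 xs unique differs fresh du = differing≤6 (_ ∷ xs) (VecAll.map (_∘ sym) fresh ∷ unique) (du ∷ differs)

  module AlternatingWalk (many : 4 < count (λ u → not (m u == m' u))) (a : Fin n) (da : Differs a) where

    b c d e f g : Fin n
    b = m a
    c = m' b
    d = m c
    e = m' d
    f = m e
    g = m' f

    db : Differs b
    db = differs-m da
    dc : Differs c
    dc = differs-m' db
    dd : Differs d
    dd = differs-m dc
    de : Differs e
    de = differs-m' dd
    df : Differs f
    df = differs-m de
    dg : Differs g
    dg = differs-m' df

    a≢b : a ≢ b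
    a≢b = mate≢ M a ∘ sym
    b≢c : b ≢ c
    b≢c = mate≢ M' b ∘ sym
    c≢d : c ≢ d
    c≢d = mate≢ M c ∘ sym
    d≢e : d ≢ e
    d≢e = mate≢ M' d ∘ sym
    e≢f : e ≢ f
    e≢f = mate≢ M e ∘ sym
    f≢g : f ≢ g
    f≢g = mate≢ M' f ∘ sym
    a≢c : a ≢ c
    a≢c = da ∘ mate-swap M'
    b≢d : b ≢ d
    b≢d = a≢c ∘ mate-injective M
    a≢d : a ≢ d
    a≢d = b≢c ∘ sym ∘ mate-swap M
    c≢e : c ≢ e
    c≢e = b≢d ∘ mate-injective M'
    b≢e : b ≢ e
    b≢e = c≢d ∘ sym ∘ mate-swap M'
    d≢f : d ≢ f
    d≢f = c≢e ∘ mate-injective M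
    c≢f : c ≢ f
    c≢f = d≢e ∘ sym ∘ mate-swap M
    e≢g : e ≢ g
    e≢g = d≢f ∘ mate-injective M'
    d≢g : d ≢ g
    d≢g = e≢f ∘ sym ∘ mate-swap M'

    -- If the walk closes after four steps, a further differing vertex u gives seven of
    -- them: u, M u, M' u and the 4-cycle.
    a≢e : a ≢ e
    a≢e a≡e with count>length⇒∃∉ (a ∷ b ∷ c ∷ d ∷ []) many
    ... | u , differ-u , u∉ = ≤⇒≯ (differing≤6 (m' u ∷ m u ∷ u ∷ a ∷ b ∷ c ∷ d ∷ []) distinct differs) ≤-refl
      where
      du : Differs u
      du = not-==⇒≢ {a = m u} {m' u} differ-u
      u≢a : u ≢ a
      u≢a eq = u∉ (here eq)
      u≢b : u ≢ b
      u≢b eq = u∉ (there (here eq))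
      u≢c : u ≢ c
      u≢c eq = u∉ (there (there (here eq)))
      u≢d : u ≢ d
      u≢d eq = u∉ (there (there (there (here eq))))
      m'a≡d : m' a ≡ d
      m'a≡d = sym (mate-swap M' a≡e)
      distinct : Vec.Unique (m' u ∷ m u ∷ u ∷ a ∷ b ∷ c ∷ d ∷ [])
      distinct = (du ∘ sym ∷ mate≢ M' u ∷ (λ eq → u≢d (trans (mate-swap M' (sym eq)) m'a≡d))
                   ∷ u≢c ∘ mate-swap M' ∘ sym ∷ u≢b ∘ mate-injective M' ∷ (λ eq → u≢a (trans (mate-swap M' (sym eq)) (sym a≡e))) ∷ [])
               ∷ (mate≢ M u ∷ u≢b ∘ mate-swap M ∘ sym ∷ u≢a ∘ mate-injective M ∷ u≢d ∘ mate-swap M ∘ sym ∷ u≢c ∘ mate-injective M ∷ [])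
               ∷ (u≢a ∷ u≢b ∷ u≢c ∷ u≢d ∷ [])
               ∷ (a≢b ∷ a≢c ∷ a≢d ∷ []) ∷ (b≢c ∷ b≢d ∷ []) ∷ (c≢d ∷ []) ∷ [] ∷ []
      differs : VecAll.All Differs (m' u ∷ m u ∷ u ∷ a ∷ b ∷ c ∷ d ∷ [])
      differs = differs-m' du ∷ differs-m du ∷ du ∷ da ∷ db ∷ dc ∷ dd ∷ []

    b≢f : b ≢ f
    b≢f = a≢e ∘ mate-injective M
    a≢f : a ≢ f
    a≢f = b≢e ∘ sym ∘ mate-swap M
    c≢g : c ≢ g
    c≢g = b≢f ∘ mate-injective M'
    b≢g : b ≢ g
    b≢g = c≢f ∘ sym ∘ mate-swap M'

    hexVertices : Vec (Fin n) 6
    hexVertices = a ∷ b ∷ c ∷ d ∷ e ∷ f ∷ []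

    hex-distinct : Vec.Unique hexVertices
    hex-distinct = (a≢b ∷ a≢c ∷ a≢d ∷ a≢e ∷ a≢f ∷ []) ∷ (b≢c ∷ b≢d ∷ b≢e ∷ b≢f ∷ []) ∷ (c≢d ∷ c≢e ∷ c≢f ∷ [])
                 ∷ (d≢e ∷ d≢f ∷ []) ∷ (e≢f ∷ []) ∷ [] ∷ []

    hex-differs : VecAll.All Differs hexVertices
    hex-differs = da ∷ db ∷ dc ∷ dd ∷ de ∷ df ∷ []

    closing : a ≡ g
    closing = decidable-stable (a ≟ g) λ a≢g →
      ≤⇒≯ (fresh≤6 hexVertices hex-distinct hex-differs (a≢g ∷ b≢g ∷ c≢g ∷ d≢g ∷ e≢g ∷ f≢g ∷ []) dg) ≤-refl

    hexagon : Hexagon M M'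
    hexagon = record
      { vertex           = lookup hexVertices
      ; vertex-injective = λ {i} {j} → lookup-injective hex-distinct i j
      ; mate-vertex      = mate-hex
      ; mate'-vertex     = mate'-hex
      ; agree-outside    = λ u out → decidable-stable (m u ≟ m' u) λ du →
                             ≤⇒≯ (fresh≤6 hexVertices hex-distinct hex-differs (lookup⁻ out) du) ≤-refl
      }
      where
      mate-hex : ∀ i → m (lookup hexVertices i) ≡ lookup hexVertices (hexM i)
      mate-hex 0F = refl
      mate-hex 1F = mate-involutive M a
      mate-hex 2F = refl
      mate-hex 3F = mate-involutive M c
      mate-hex 4F = refl
      mate-hex 5F = mate-involutive M e
      mate'-hex : ∀ i → m' (lookup hexVertices i) ≡ lookup hexVertices (hexM' i)
      mate'-hex 0F = sym (mate-swap M' closing)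
      mate'-hex 1F = refl
      mate'-hex 2F = mate-involutive M' b
      mate'-hex 3F = refl
      mate'-hex 4F = mate-involutive M' d
      mate'-hex 5F = sym closing

  >4⇒hexagon : 4 < symDiffSize M M' → Hexagon M M'
  >4⇒hexagon >4 = start (count>length⇒∃∉ [] (≤-trans (s≤s z≤n) many))
    where
    many : 4 < count (λ u → not (m u == m' u))
    many = subst (4 <_) (symDiffSize≡count-differ M M') >4
    start : (∃ λ a → not (m a == m' a) ≡ true × a ∉ []) → Hexagon M M'
    start (a , differ-a , _) = AlternatingWalk.hexagon many a (not-==⇒≢ {a = m a} {m' a} differ-a)

  ≤4⊎hexagon : symDiffSize M M' ≤ 4 ⊎ Hexagon M M'
  ≤4⊎hexagon with symDiffSize M M' ≤? 4
  ... | yes ≤4 = inj₁ ≤4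
  ... | no  ≰4 = inj₂ (>4⇒hexagon (≰⇒> ≰4))

-- Degrees into the hexagon

ore-threshold : ∀ n → n * 8 < 3 * suc (4 * n / 3) + 3 * suc (4 * n / 3)
ore-threshold n = begin-strict
  n * 8                           ≡⟨ split-8n n ⟩
  4 * n + 4 * n                   ≤⟨ +-mono-≤ 4n≤2+3q 4n≤2+3q ⟩
  (2 + q * 3) + (2 + q * 3)       <⟨ m<n+m _ {2} (s≤s z≤n) ⟩
  2 + ((2 + q * 3) + (2 + q * 3)) ≡⟨ collect q ⟩
  3 * suc q + 3 * suc q           ∎
  where
  open ≤-Reasoning
  q = 4 * n / 3
  4n≤2+3q : 4 * n ≤ 2 + q * 3
  4n≤2+3q = begin
    4 * n                 ≡⟨ m≡m%n+[m/n]*n (4 * n) 3 ⟩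
    4 * n % 3 + q * 3     ≤⟨ +-monoˡ-≤ (q * 3) (≤-pred (m%n<n (4 * n) 3)) ⟩
    2 + q * 3             ∎
  split-8n : ∀ n → n * 8 ≡ 4 * n + 4 * n
  split-8n = solve-∀
  collect : ∀ q → 2 + ((2 + q * 3) + (2 + q * 3)) ≡ 3 * suc q + 3 * suc q
  collect = solve-∀

module HexagonCase {G : Graph n} {M M' : PerfectMatching G} (H : Hexagon M M') where

  open Window H
  private
    m : Fin n → Fin n
    m = mate M

  diagonalBits : Vec Bool 3
  diagonalBits = adj G (vertex 0F) (vertex 3F) ∷ adj G (vertex 1F) (vertex 4F) ∷ adj G (vertex 2F) (vertex 5F) ∷ []

  diagonal-bit : ∀ i → lookup diagonalBits (axis i) ≡ adj G (vertex i) (vertex (opposite i))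
  diagonal-bit 0F = refl
  diagonal-bit 1F = refl
  diagonal-bit 2F = refl
  diagonal-bit 3F = adj-sym G (vertex 0F) (vertex 3F)
  diagonal-bit 4F = adj-sym G (vertex 1F) (vertex 4F)
  diagonal-bit 5F = adj-sym G (vertex 2F) (vertex 5F)

  diagonals-sound : ∀ i j → diagonals diagonalBits i j ≡ true → adj G (vertex i) (vertex j) ≡ true
  diagonals-sound i j eq with ==⇒≡ {a = j} (∧-conicalˡ _ _ eq)
  ... | refl = trans (sym (diagonal-bit i)) (∧-conicalʳ _ _ eq)

  NoDiagonal : Set
  NoDiagonal = ∀ i → adj G (vertex i) (vertex (opposite i)) ≡ false

  diagonal⊎noDiagonal : (∃ λ a → lookup diagonalBits a ≡ true) ⊎ NoDiagonal
  diagonal⊎noDiagonal with any? (λ a → lookup diagonalBits a ≟ᵇ true)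
  ... | yes diagonal = inj₁ diagonal
  ... | no  none     = inj₂ λ i → trans (sym (diagonal-bit i)) (¬-not λ bit → none (axis i , bit))

  diagonal⇒equiv : (∃ λ a → lookup diagonalBits a ≡ true) → Equiv2Switch M M'
  diagonal⇒equiv diagonal =
    Switching.switchable⇒equiv M M' H (diagonals diagonalBits) diagonals-sound (hexagon-switchable diagonalBits diagonal)

  ∑degIn≡∑deg : sum degIn ≡ sum (deg G ∘ vertex)
  ∑degIn≡∑deg = begin
    sum degIn                                       ≡⟨ sum-cong-≗ (λ u → count≡sum (λ i → adj G u (vertex i))) ⟩
    sum (λ u → sum (λ i → 𝟙 (adj G u (vertex i)))) ≡⟨ ∑-comm (λ u i → 𝟙 (adj G u (vertex i))) ⟩
    sum (λ i → sum (λ u → 𝟙 (adj G u (vertex i)))) ≡⟨ sum-cong-≗ (λ i → sum-cong-≗ λ u → cong 𝟙 (adj-sym G u (vertex i))) ⟩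
    sum (λ i → sum (𝟙 ∘ adj G (vertex i)))          ≡⟨ sum-cong-≗ (λ i → sym (count≡sum (adj G (vertex i)))) ⟩
    sum (deg G ∘ vertex)                            ∎
    where open ≡-Reasoning

  ∑degIn∘mate≡∑degIn : sum (degIn ∘ m) ≡ sum degIn
  ∑degIn∘mate≡∑degIn = sym (sum-permute degIn (permutation m m (mate-involutive M) (mate-involutive M)))

  heavy-edge : (c : ℕ) → n * c < sum (deg G ∘ vertex) + sum (deg G ∘ vertex) → ∃ λ u → c < degIn u + degIn (m u)
  heavy-edge c big with any? (λ u → c <? degIn u + degIn (m u))
  ... | yes heavy = heavy
  ... | no  none  = ⊥-elim (<⇒≱ big (begin
    sum (deg G ∘ vertex) + sum (deg G ∘ vertex) ≡⟨ cong₂ _+_ (sym ∑degIn≡∑deg) (trans (sym ∑degIn≡∑deg) (sym ∑degIn∘mate≡∑degIn)) ⟩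
    sum degIn + sum (degIn ∘ m)                 ≡⟨ ∑-distrib-+ degIn (degIn ∘ m) ⟨
    sum (λ u → degIn u + degIn (m u))           ≤⟨ sum-bound c (λ u → ≮⇒≥ (λ c< → none (u , c<))) ⟩
    n * c                                       ∎))
    where open ≤-Reasoning

  heavy⇒outside : (c : ℕ) → (∀ i → degIn (vertex i) ≤ c) → ∀ {u} → c + c < degIn u + degIn (m u) → Outside u
  heavy⇒outside c light {u} heavy i refl = <⇒≱ heavy (+-mono-≤ (light i) (subst (λ w → degIn w ≤ c) (sym (mate-vertex i)) (light (hexM i))))

  octagon⇒equiv : ∀ {x} (x-out : Outside x) → OctagonSwitchable (neighbourBits x) (neighbourBits (m x)) → Equiv2Switch M M'
  octagon⇒equiv {x} x-out =
    Switching.switchable⇒equiv M M' (Extension.extended M M' H x x-out) (attach (neighbourBits x) (neighbourBits (m x)))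
      (Extension.attach-sound M M' H x x-out)

  opposite-pairs : ∀ {q} → (∀ i → q ≤ deg G (vertex i) + deg G (vertex (opposite i))) → 3 * q ≤ sum (deg G ∘ vertex)
  opposite-pairs {q} bound = begin
    3 * q                                                  ≡⟨ three-times q ⟩
    q + (q + q)                                            ≤⟨ +-mono-≤ (bound 0F) (+-mono-≤ (bound 1F) (bound 2F)) ⟩
    d 0F + d 3F + (d 1F + d 4F + (d 2F + d 5F))            ≡⟨ regroup (d 0F) (d 1F) (d 2F) (d 3F) (d 4F) (d 5F) ⟩
    sum d                                                  ∎
    where
    open ≤-Reasoning
    d : Fin 6 → ℕ
    d = deg G ∘ vertex
    three-times : ∀ q → 3 * q ≡ q + (q + q)
    three-times = solve-∀
    regroup : ∀ d₀ d₁ d₂ d₃ d₄ d₅ → d₀ + d₃ + (d₁ + d₄ + (d₂ + d₅)) ≡ d₀ + (d₁ + (d₂ + (d₃ + (d₄ + (d₅ + 0)))))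
    regroup = solve-∀

-- The Ore-type conditions

module GeneralCase {G : Graph n} (ore : OreCondition G) {M M' : PerfectMatching G} (H : Hexagon M M') where

  open Window H
  open HexagonCase H

  module _ (noDiagonal : NoDiagonal) where

    degIn-vertex≤4 : ∀ i → degIn (vertex i) ≤ 4
    degIn-vertex≤4 i = ≤-trans (count-mono candidate) (≤-reflexive (count-non-opposite i))
      where
      candidate : ∀ j → adj G (vertex i) (vertex j) ≡ true → (not (j == i) ∧ not (j == opposite i)) ≡ true
      candidate j e with j ≟ i | j ≟ opposite i
      ... | yes refl | _        with () ← trans (sym e) (irrefl G (vertex j))
      ... | no  _    | yes refl with () ← trans (sym e) (noDiagonal i)
      ... | no  _    | no  _    = refl

    degrees : n * 8 < sum (deg G ∘ vertex) + sum (deg G ∘ vertex)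
    degrees = <-≤-trans (ore-threshold n) (+-mono-≤ three-pairs three-pairs)
      where
      three-pairs = opposite-pairs λ i → ore (vertex i) (vertex (opposite i)) (opposite-≢ i ∘ vertex-injective) (noDiagonal i)

    noDiagonal⇒equiv : Equiv2Switch M M'
    noDiagonal⇒equiv = octagon (heavy-edge 8 degrees)
      where
      octagon : (∃ λ x → 8 < degIn x + degIn (mate M x)) → Equiv2Switch M M'
      octagon (x , heavy) = octagon⇒equiv (heavy⇒outside 4 degIn-vertex≤4 heavy)
                              (dense-octagon-switchable (neighbourBits x) (neighbourBits (mate M x))
                                 (subst (9 ≤_) (sym (cong₂ _+_ (weight-neighbourBits x) (weight-neighbourBits (mate M x)))) heavy))

  hexagon⇒equiv : Equiv2Switch M M'
  hexagon⇒equiv = [ diagonal⇒equiv , noDiagonal⇒equiv ]′ diagonal⊎noDiagonal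

module BipartiteCase {n} {G : Graph (n + n)} (B : BalancedBipartition n G) (ore : BipOreCondition B)
                     {M M' : PerfectMatching G} (H : Hexagon M M') where

  open Window H
  open HexagonCase H

  private
    m : Fin (n + n) → Fin (n + n)
    m = mate M

  s₀ : Bool
  s₀ = side B (vertex 0F)

  sideOf : Bool → Bool
  sideOf b = if b then s₀ else not s₀

  sideOf-injective : ∀ {b c} → sideOf b ≡ sideOf c → b ≡ c
  sideOf-injective {true}  {true}  _  = refl
  sideOf-injective {true}  {false} eq = ⊥-elim (not-¬ refl eq)
  sideOf-injective {false} {true}  eq = ⊥-elim (not-¬ refl (sym eq))
  sideOf-injective {false} {false} _  = refl

  side-step : ∀ {u v} → adj G u v ≡ true → side B v ≡ not (side B u)
  side-step {u} {v} e = ¬-not λ eq → crossing B u v e (sym eq)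

  side-vertex : ∀ i → side B (vertex i) ≡ sideOf (isEven i)
  side-vertex = table
    where
    side₁ : side B (vertex 1F) ≡ not s₀
    side₁ = side-step (adj-p 0F)
    side₂ : side B (vertex 2F) ≡ s₀
    side₂ = trans (side-step (adj-p' 1F)) (trans (cong not side₁) (not-involutive s₀))
    side₃ : side B (vertex 3F) ≡ not s₀
    side₃ = trans (side-step (adj-p 2F)) (cong not side₂)
    side₄ : side B (vertex 4F) ≡ s₀
    side₄ = trans (side-step (adj-p' 3F)) (trans (cong not side₃) (not-involutive s₀))
    side₅ : side B (vertex 5F) ≡ not s₀
    side₅ = trans (side-step (adj-p 4F)) (cong not side₄)
    table : ∀ i → side B (vertex i) ≡ sideOf (isEven i)
    table 0F = refl
    table 1F = side₁
    table 2F = side₂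
    table 3F = side₃
    table 4F = side₄
    table 5F = side₅

  parity-of-side : ∀ {i b} → side B (vertex i) ≡ sideOf b → isEven i ≡ b
  parity-of-side {i} eq = sideOf-injective (trans (sym (side-vertex i)) eq)

  module _ (noDiagonal : NoDiagonal) where

    degIn-vertex≤2 : ∀ i → degIn (vertex i) ≤ 2
    degIn-vertex≤2 i = ≤-trans (count-mono candidate) (≤-reflexive (count-other-parity-non-opposite i))
      where
      candidate : ∀ j → adj G (vertex i) (vertex j) ≡ true → (not (does (isEven j ≟ᵇ isEven i)) ∧ not (j == opposite i)) ≡ true
      candidate j e with isEven j ≟ᵇ isEven i | j ≟ opposite i
      ... | yes same | _        = ⊥-elim (crossing B (vertex i) (vertex j) e (trans (side-vertex i) (trans (cong sideOf (sym same)) (sym (side-vertex j)))))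
      ... | no  _    | yes refl with () ← trans (sym e) (noDiagonal i)
      ... | no  _    | no  _    = refl

    opposite-sides : ∀ i → side B (vertex i) ≢ side B (vertex (opposite i))
    opposite-sides i eq = not-¬ (parity-of-side {opposite i} (trans (sym eq) (side-vertex i))) (isEven-opposite i)

    degrees : (n + n) * 4 < sum (deg G ∘ vertex) + sum (deg G ∘ vertex)
    degrees = subst (_< sum (deg G ∘ vertex) + sum (deg G ∘ vertex)) (double n) (<-≤-trans (ore-threshold n) (+-mono-≤ three-pairs three-pairs))
      where
      three-pairs = opposite-pairs λ i → ore (vertex i) (vertex (opposite i)) (opposite-sides i) (noDiagonal i)
      double : ∀ n → n * 8 ≡ (n + n) * 4
      double = solve-∀

    far-side-heavy-edge : ∃ λ x → side B x ≡ not s₀ × 4 < degIn x + degIn (m x)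
    far-side-heavy-edge = orient (heavy-edge 4 degrees)
      where
      orient : (∃ λ u → 4 < degIn u + degIn (m u)) → ∃ λ x → side B x ≡ not s₀ × 4 < degIn x + degIn (m x)
      orient (u , heavy) with side B u ≟ᵇ s₀
      ... | no  u≢s₀ = u , ¬-not u≢s₀ , heavy
      ... | yes u≡s₀ = m u , trans (side-step (mate-adj M u)) (cong not u≡s₀) ,
                       subst (λ w → 4 < degIn (m u) + degIn w) (sym (mate-involutive M u)) (subst (4 <_) (+-comm (degIn u) (degIn (m u))) heavy)

    noDiagonal⇒equiv : Equiv2Switch M M'
    noDiagonal⇒equiv = octagon far-side-heavy-edge
      where
      octagon : (∃ λ x → side B x ≡ not s₀ × 4 < degIn x + degIn (m x)) → Equiv2Switch M M'
      octagon (x , far , heavy) = octagon⇒equiv (heavy⇒outside 2 degIn-vertex≤2 heavy)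
                                    (bipartite-octagon-switchable (neighbourBits x) (neighbourBits (m x)) x-even mx-odd
                                       (subst (5 ≤_) (sym (cong₂ _+_ (weight-neighbourBits x) (weight-neighbourBits (m x)))) heavy))
        where
        x-even : ∀ i → lookup (neighbourBits x) i ≡ true → isEven i ≡ true
        x-even i e = parity-of-side {i} (trans (side-step (trans (sym (lookup∘tabulate (λ j → adj G x (vertex j)) i)) e))
                                           (trans (cong not far) (not-involutive s₀)))
        mx-odd : ∀ i → lookup (neighbourBits (m x)) i ≡ true → isEven i ≡ false
        mx-odd i e = parity-of-side {i} (trans (side-step (trans (sym (lookup∘tabulate (λ j → adj G (m x) (vertex j)) i)) e))
                                           (cong not (trans (side-step (mate-adj M x)) (trans (cong not far) (not-involutive s₀)))))

  hexagon⇒equiv : Equiv2Switch M M'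
  hexagon⇒equiv = [ diagonal⇒equiv , noDiagonal⇒equiv ]′ diagonal⊎noDiagonal
lemma3p5 : ((n : ℕ) (G : Graph n) → OreCondition G →
             (M M' : PerfectMatching G) → symDiffSize M M' ≤ 6 → Equiv2Switch M M')
           × ((n : ℕ) (G : Graph (n + n)) (B : BalancedBipartition n G) → BipOreCondition B →
             (M M' : PerfectMatching G) → symDiffSize M M' ≤ 6 → Equiv2Switch M M')
lemma3p5 =
    (λ _ _ ore M M' ≤6 → [ (_◅ ε) , GeneralCase.hexagon⇒equiv ore ]′ (Structure.≤4⊎hexagon M M' ≤6))
  , (λ _ _ B ore M M' ≤6 → [ (_◅ ε) , BipartiteCase.hexagon⇒equiv B ore ]′ (Structure.≤4⊎hexagon M M' ≤6))
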